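{- For $e\geq 2$, let $\mathcal{R}^{(e)}$ be the set of rooted wheels whose wheel-sequence can be written as $e$ concatenated copies of an integer sequence, and let $R^{(e)}(x,u)$ be its generating function with respect to size ($x$) and number of diameters ($u$). Then the generating function of rotation-wheels is $$R^{+}(x,u)=\sum_{e\geq 2}\phi(e)R^{(e)}(x,u),$$ where $\phi$ is Euler's totient function.
   Context: For $k\geq 1$, a wheel-sequence of length $2k$ is a sequence $(a_1,\ldots,a_{2k})$ of nonnegative integers such that for every $1\le i\le 2k$ (indices mod $2k$), $a_i$ and $a_{i+k}$ are not both $0$, and $a_i$ and $a_{i+1}$ are not both $0$; its size is $\sum a_i$. A rooted wheel with $k$ diameters is a wheel-sequence of length $2k$. The rotation $(l,+)$, $l\in\mathbf{Z}_{2k}$, acts by $(l,+)\cdot(a_1,\ldots,a_{2k})=(a_{1+l},\ldots,a_{2k},a_1,\ldots,a_l)$. A rotation-wheel is a pair consisting of a wheel-sequence $s$ of length $2k$ and an element $(l,+)$ with $l\neq0$ fixing $s$; $R^+(x,u)$ is the generating function of rotation-wheels counted by size ($x$) and number of diameters $k$ ($u$). -}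

module Defs where

open import Data.Nat using (ℕ; zero; suc; _+_; _*_; _∸_; _≤_; _<_; s≤s)
open import Data.Nat.Properties using (_≟_; m≤m+n)
open import Data.Nat.DivMod using (_mod_)
open import Data.Nat.GCD using (gcd)
open import Data.Fin using (Fin; toℕ; fromℕ<) renaming (zero to fzero; suc to fsuc)
open import Data.Fin.Properties using (all?; any?; toℕ-fromℕ<)
open import Data.Vec using (Vec; []; _∷_; lookup; tabulate; toList)
import Data.Vec.Properties as VecP
open import Data.List using (List; []; _∷_; _++_; map; concat; concatMap; replicate; take; length; filter; upTo; sum; cartesianProduct)
import Data.List.Properties as ListP
open import Data.Product using (Σ; ∃; _×_; _,_; proj₁; proj₂)
open import Relation.Nullary using (Dec; yes; no; ¬_; map′)
open import Relation.Nullary.Decidable using (_×-dec_; ¬?)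
open import Relation.Binary.PropositionalEquality using (_≡_; refl; cong; subst; sym; trans)

seqs : (m n : ℕ) → List (Vec ℕ m)
seqs zero    zero    = [] ∷ []
seqs zero    (suc n) = []
seqs (suc m) n       = concatMap (λ a → map (a ∷_) (seqs m (n ∸ a))) (upTo (suc n))

shift : ∀ {m} → Fin m → ℕ → Fin m
shift {suc m} i j = (toℕ i + j) mod (suc m)

-- Wheel-sequences of length 2k (k diameters).
-- For all i (indices mod 2k): a_i, a_{i+k} not both 0, and a_i, a_{i+1}
-- not both 0.

IsWheel : (k : ℕ) → Vec ℕ (k + k) → Set
IsWheel k s = ∀ i →
  ¬ (lookup s i ≡ 0 × lookup s (shift i k) ≡ 0) ×
  ¬ (lookup s i ≡ 0 × lookup s (shift i 1) ≡ 0)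

isWheel? : (k : ℕ) (s : Vec ℕ (k + k)) → Dec (IsWheel k s)
isWheel? k s = all? λ i →
  ¬? ((lookup s i ≟ 0) ×-dec (lookup s (shift i k) ≟ 0)) ×-dec
  ¬? ((lookup s i ≟ 0) ×-dec (lookup s (shift i 1) ≟ 0))

-- rooted wheels with k diameters and size n
wheels : (k n : ℕ) → List (Vec ℕ (k + k))
wheels k n = filter (isWheel? k) (seqs (k + k) n)

rotate : ∀ {m} → Fin m → Vec ℕ m → Vec ℕ m
rotate l s = tabulate (λ i → lookup s (shift i (toℕ l)))

-- a rotation-wheel: a wheel-sequence s together with l ≠ 0 fixing s
IsRotWheel : (k : ℕ) → Vec ℕ (k + k) × Fin (k + k) → Set
IsRotWheel k (s , l) = ¬ (toℕ l ≡ 0) × rotate l s ≡ s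

isRotWheel? : (k : ℕ) (p : Vec ℕ (k + k) × Fin (k + k)) → Dec (IsRotWheel k p)
isRotWheel? k (s , l) = ¬? (toℕ l ≟ 0) ×-dec VecP.≡-dec _≟_ (rotate l s) s

allFin : (m : ℕ) → List (Fin m)
allFin m = Data.List.tabulate (λ i → i)
  where import Data.List

-- number of rotation-wheels with k diameters and size n
-- (coefficient of x^n u^k in R⁺(x,u))
rotWheelCount : (k n : ℕ) → ℕ
rotWheelCount k n =
  length (filter (isRotWheel? k) (cartesianProduct (wheels k n) (allFin (k + k))))

IsPower : (e : ℕ) → List ℕ → Set
IsPower e xs = ∃ λ (t : List ℕ) → xs ≡ concat (replicate e t)

private
  take-len : (t r : List ℕ) → take (length t) (t ++ r) ≡ t
  take-len []      r = refl
  take-len (x ∷ t) r = cong (x ∷_) (take-len t r)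

  back : (e : ℕ) (xs : List ℕ) → IsPower e xs →
         ∃ λ (j : Fin (suc (length xs))) → xs ≡ concat (replicate e (take (toℕ j) xs))
  back zero     xs (t , p) = fzero , p
  back (suc e′) xs (t , p) = j , q
    where
    r = concat (replicate e′ t)
    lt : length t < suc (length xs)
    lt = s≤s (subst (length t ≤_) (trans (sym (ListP.length-++ t)) (cong length (sym p))) (m≤m+n (length t) (length r)))
    j = fromℕ< lt
    tk : take (toℕ j) xs ≡ t
    tk rewrite toℕ-fromℕ< lt | p = take-len t r
    q : xs ≡ concat (replicate (suc e′) (take (toℕ j) xs))
    q rewrite tk = p

isPower? : (e : ℕ) (xs : List ℕ) → Dec (IsPower e xs)
isPower? e xs =
  map′ (λ (j , p) → take (toℕ j) xs , p) (back e xs)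
       (any? {n = suc (length xs)} (λ j → ListP.≡-dec _≟_ xs (concat (replicate e (take (toℕ j) xs)))))

-- coefficient of x^n u^k in R^{(e)}(x,u)
powerWheelCount : (e k n : ℕ) → ℕ
powerWheelCount e k n = length (filter (λ s → isPower? e (toList s)) (wheels k n))

φ : ℕ → ℕ
φ e = length (filter (λ i → gcd i e ≟ 1) (map suc (upTo e)))

from2to : ℕ → List ℕ
from2to N = map (2 +_) (upTo (N ∸ 1))

{-# OPTIONS --safe #-}

-- Rotation by l fixes a sequence s of length M iff s has period gcd(l, M), and s is e
-- concatenated copies of a block iff e ∣ M and s has period M/e. The l < M with
-- gcd(l, M) = M/e are the j·M/e with j < e coprime to e, so there are φ(e) of them, and
-- the rotations fixing s number Σ_{e ∣ M} φ(e)·[s is e copies of a block]. The term e = 1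
-- is the identity rotation; the others, summed over all wheels, give the theorem.

module Submission where

open import Defs
open import Level using (Level)
open import Data.Nat using (ℕ; zero; suc; _+_; _*_; _≤_; _<_; z<s; s<s; NonZero; ≢-nonZero; _⊓_)
open import Data.Nat.Properties
open import Algebra.Properties.CommutativeSemigroup +-commutativeSemigroup using (interchange; xy∙z≈xz∙y; x∙yz≈y∙xz)
open import Data.Nat.DivMod
open import Data.Nat.Divisibility using (_∣_; divides; _∣?_; ∣m+n∣m⇒∣n; ∣⇒≤; n∣m*n; ∣-refl; ∣-antisym)
open import Data.Nat.GCD using (gcd; gcd[m,n]∣m; gcd[m,n]∣n; gcd-greatest; gcd-identityˡ; c*gcd[m,n]≡gcd[cm,cn]; gcd-GCD; module Bézout)
open import Data.Nat.ListAction using (sum)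
open import Data.Nat.ListAction.Properties using (sum-++)
open import Data.Fin using (Fin; toℕ) renaming (zero to fzero; suc to fsuc)
open import Data.Fin.Properties using (toℕ-fromℕ<; toℕ<n; all?)
open import Data.List using (List; []; _∷_; _++_; map; applyUpTo; upTo; length; filter; concat; replicate; take; tabulate; cartesianProduct)
open import Data.List.Properties using (map-++; map-cong; map-∘; map-tabulate; map-upTo; length-++; length-take; ++-identityʳ)
open import Data.Vec using (Vec; lookup; toList) renaming (_∷_ to _∷ᵥ_)
open import Data.Vec.Properties using (≡-dec; lookup∘tabulate; tabulate-cong; tabulate∘lookup; length-toList)
open import Data.Product using (_×_; _,_; ∃-syntax)
open import Function using (_∘_; _⇔_; mk⇔; Equivalence)
open import Function.Properties.Equivalence using () renaming (trans to ⇔-trans)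
open import Relation.Nullary using (Dec; yes; no; ¬_; map′; contradiction)
open import Relation.Nullary.Decidable using (_×-dec_; ¬?)
open import Relation.Unary using (Decidable)
open import Relation.Binary.PropositionalEquality using (_≡_; refl; sym; trans; cong; cong₂; subst; module ≡-Reasoning)

open Equivalence using (to; from)
open ≡-Reasoning

private variable
  a ℓ ℓ′ : Level
  A B : Set a
  P : Set ℓ
  Q : Set ℓ′

-- Indicators and finite sums

𝟙 : Dec P → ℕ
𝟙 (yes _) = 1
𝟙 (no _)  = 0

𝟙-yes : (P? : Dec P) → P → 𝟙 P? ≡ 1
𝟙-yes (yes _) _ = refl
𝟙-yes (no ¬p) p = contradiction p ¬p

𝟙-no : (P? : Dec P) → ¬ P → 𝟙 P? ≡ 0
𝟙-no (yes p) ¬p = contradiction p ¬p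
𝟙-no (no _)  _  = refl

𝟙-cong : (P? : Dec P) (Q? : Dec Q) → P ⇔ Q → 𝟙 P? ≡ 𝟙 Q?
𝟙-cong P? (yes q) P⇔Q = 𝟙-yes P? (from P⇔Q q)
𝟙-cong P? (no ¬q) P⇔Q = 𝟙-no P? (¬q ∘ to P⇔Q)

𝟙-× : (P? : Dec P) (Q? : Dec Q) → 𝟙 (P? ×-dec Q?) ≡ 𝟙 P? * 𝟙 Q?
𝟙-× (yes _) (yes _) = refl
𝟙-× (yes _) (no _)  = refl
𝟙-× (no _)  _       = refl

∑< : ℕ → (ℕ → ℕ) → ℕ
∑< n f = sum (applyUpTo f n)

syntax ∑< n (λ i → f) = ∑[ i < n ] f

∑-cong : ∀ n {f g : ℕ → ℕ} → (∀ {i} → i < n → f i ≡ g i) → ∑< n f ≡ ∑< n g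
∑-cong zero    _   = refl
∑-cong (suc n) f≡g = cong₂ _+_ (f≡g z<s) (∑-cong n (f≡g ∘ s<s))

∑-zero : ∀ n {f : ℕ → ℕ} → (∀ {i} → i < n → f i ≡ 0) → ∑< n f ≡ 0
∑-zero zero    _   = refl
∑-zero (suc n) f≡0 = cong₂ _+_ (f≡0 z<s) (∑-zero n (f≡0 ∘ s<s))

∑-distrib-+ : ∀ n (f g : ℕ → ℕ) → ∑[ i < n ] (f i + g i) ≡ ∑< n f + ∑< n g
∑-distrib-+ zero    f g = refl
∑-distrib-+ (suc n) f g =
  trans (cong (f 0 + g 0 +_) (∑-distrib-+ n (f ∘ suc) (g ∘ suc)))
        (interchange (f 0) (g 0) _ _)

∑-distribʳ-* : ∀ n (f : ℕ → ℕ) c → ∑[ i < n ] (f i * c) ≡ ∑< n f * c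
∑-distribʳ-* zero    f c = refl
∑-distribʳ-* (suc n) f c =
  trans (cong (f 0 * c +_) (∑-distribʳ-* n (f ∘ suc) c)) (sym (*-distribʳ-+ c (f 0) _))

∑-comm : ∀ m n (f : ℕ → ℕ → ℕ) → ∑[ i < m ] ∑[ j < n ] f i j ≡ ∑[ j < n ] ∑[ i < m ] f i j
∑-comm zero    n f = sym (∑-zero n (λ _ → refl))
∑-comm (suc m) n f =
  trans (cong (∑< n (f 0) +_) (∑-comm m n (f ∘ suc))) (sym (∑-distrib-+ n (f 0) _))

∑-last : ∀ n (f : ℕ → ℕ) → ∑< (suc n) f ≡ ∑< n f + f n
∑-last zero    f = +-comm (f 0) 0
∑-last (suc n) f = trans (cong (f 0 +_) (∑-last n (f ∘ suc))) (sym (+-assoc (f 0) _ _))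

∑-split : ∀ m n (f : ℕ → ℕ) → ∑< (m + n) f ≡ ∑< m f + ∑[ i < n ] f (m + i)
∑-split zero    n f = refl
∑-split (suc m) n f = trans (cong (f 0 +_) (∑-split m n (f ∘ suc))) (sym (+-assoc (f 0) _ _))

∑-blocks : ∀ m n (f : ℕ → ℕ) → ∑< (m * n) f ≡ ∑[ q < m ] ∑[ r < n ] f (q * n + r)
∑-blocks zero    n f = refl
∑-blocks (suc m) n f = begin
  ∑< (n + m * n) f
    ≡⟨ ∑-split n (m * n) f ⟩
  ∑< n f + ∑[ i < m * n ] f (n + i)
    ≡⟨ cong (∑< n f +_) (∑-blocks m n (λ i → f (n + i))) ⟩
  ∑< n f + ∑[ q < m ] ∑[ r < n ] f (n + (q * n + r))
    ≡⟨ cong (∑< n f +_) (∑-cong m λ _ → ∑-cong n λ _ → cong f (sym (+-assoc n _ _))) ⟩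
  ∑[ q < suc m ] ∑[ r < n ] f (q * n + r)  ∎

∑-𝟙-unique : ∀ n {P : ℕ → Set ℓ} (P? : Decidable P) {i₀} →
             i₀ < n → P i₀ → (∀ {i} → P i → i ≡ i₀) → ∑[ i < n ] 𝟙 (P? i) ≡ 1
∑-𝟙-unique (suc n) P? {zero} _ P0 unique =
  cong₂ _+_ (𝟙-yes (P? 0) P0) (∑-zero n λ {i} _ → 𝟙-no (P? (suc i)) (1+n≢0 ∘ unique))
∑-𝟙-unique (suc n) P? {suc i₀} (s<s i₀<n) Pi₀ unique =
  cong₂ _+_ (𝟙-no (P? 0) (0≢1+n ∘ unique)) (∑-𝟙-unique n (P? ∘ suc) i₀<n Pi₀ (suc-injective ∘ unique))

length-filter≡sum-𝟙 : ∀ {P : A → Set ℓ} (P? : Decidable P) xs →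
                      length (filter P? xs) ≡ sum (map (𝟙 ∘ P?) xs)
length-filter≡sum-𝟙 P? []       = refl
length-filter≡sum-𝟙 P? (x ∷ xs) with P? x
... | yes _ = cong suc (length-filter≡sum-𝟙 P? xs)
... | no _  = length-filter≡sum-𝟙 P? xs

sum-map-zero : (xs : List A) → sum (map (λ _ → 0) xs) ≡ 0
sum-map-zero []       = refl
sum-map-zero (_ ∷ xs) = sum-map-zero xs

sum-map-+ : ∀ (f g : A → ℕ) xs → sum (map (λ x → f x + g x) xs) ≡ sum (map f xs) + sum (map g xs)
sum-map-+ f g []       = refl
sum-map-+ f g (x ∷ xs) =
  trans (cong (f x + g x +_) (sum-map-+ f g xs)) (interchange (f x) (g x) _ _)

sum-map-*ˡ : ∀ c (f : A → ℕ) xs → sum (map (λ x → c * f x) xs) ≡ c * sum (map f xs)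
sum-map-*ˡ c f []       = sym (*-zeroʳ c)
sum-map-*ˡ c f (x ∷ xs) = trans (cong (c * f x +_) (sum-map-*ˡ c f xs)) (sym (*-distribˡ-+ c (f x) _))

sum-map-comm : ∀ (f : A → B → ℕ) xs ys →
  sum (map (λ x → sum (map (f x) ys)) xs) ≡ sum (map (λ y → sum (map (λ x → f x y) xs)) ys)
sum-map-comm f []       ys = sym (sum-map-zero ys)
sum-map-comm f (x ∷ xs) ys =
  trans (cong (sum (map (f x) ys) +_) (sum-map-comm f xs ys)) (sym (sum-map-+ (f x) _ ys))

sum-map-cartesianProduct : ∀ (f : A × B → ℕ) xs ys →
  sum (map f (cartesianProduct xs ys)) ≡ sum (map (λ x → sum (map (λ y → f (x , y)) ys)) xs)
sum-map-cartesianProduct f []       ys = refl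
sum-map-cartesianProduct f (x ∷ xs) ys = begin
  sum (map f (map (x ,_) ys ++ cartesianProduct xs ys))
    ≡⟨ cong sum (map-++ f (map (x ,_) ys) _) ⟩
  sum (map f (map (x ,_) ys) ++ map f (cartesianProduct xs ys))
    ≡⟨ sum-++ (map f (map (x ,_) ys)) _ ⟩
  sum (map f (map (x ,_) ys)) + sum (map f (cartesianProduct xs ys))
    ≡⟨ cong₂ _+_ (cong sum (sym (map-∘ ys))) (sum-map-cartesianProduct f xs ys) ⟩
  sum (map (λ y → f (x , y)) ys) + sum (map (λ x → sum (map (λ y → f (x , y)) ys)) xs) ∎

sum-tabulate : ∀ n {f : Fin n → ℕ} {g : ℕ → ℕ} → (∀ i → f i ≡ g (toℕ i)) →
               sum (tabulate f) ≡ ∑< n g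
sum-tabulate zero    _   = refl
sum-tabulate (suc n) f≡g = cong₂ _+_ (f≡g fzero) (sum-tabulate n (f≡g ∘ fsuc))

sum-map-upTo : ∀ (f : ℕ → ℕ) n → sum (map f (upTo n)) ≡ ∑< n f
sum-map-upTo f n = cong sum (map-upTo f n)

-- Counting by greatest common divisor

gcd[n,n]≡n : ∀ n → gcd n n ≡ n
gcd[n,n]≡n n = ∣-antisym (gcd[m,n]∣m n n) (gcd-greatest ∣-refl ∣-refl)

φ≡∑-coprime : ∀ e → φ e ≡ ∑[ j < e ] 𝟙 (gcd j e ≟ 1)
φ≡∑-coprime e = +-cancelˡ-≡ (coprime 0) _ _ (begin
  coprime 0 + φ e                  ≡⟨ cong (coprime 0 +_) φ≡∑-from-1 ⟩
  ∑< (suc e) coprime               ≡⟨ ∑-last e coprime ⟩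
  ∑< e coprime + coprime e         ≡⟨ cong (∑< e coprime +_) coprime-e≡coprime-0 ⟩
  ∑< e coprime + coprime 0         ≡⟨ +-comm (∑< e coprime) (coprime 0) ⟩
  coprime 0 + ∑< e coprime         ∎)
  where
  coprime : ℕ → ℕ
  coprime j = 𝟙 (gcd j e ≟ 1)
  φ≡∑-from-1 : φ e ≡ ∑[ i < e ] coprime (suc i)
  φ≡∑-from-1 = begin
    φ e                                   ≡⟨ length-filter≡sum-𝟙 (λ i → gcd i e ≟ 1) (map suc (upTo e)) ⟩
    sum (map coprime (map suc (upTo e)))  ≡⟨ cong sum (sym (map-∘ (upTo e))) ⟩
    sum (map (coprime ∘ suc) (upTo e))    ≡⟨ sum-map-upTo (coprime ∘ suc) e ⟩
    ∑[ i < e ] coprime (suc i)            ∎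
  coprime-e≡coprime-0 : coprime e ≡ coprime 0
  coprime-e≡coprime-0 = cong (λ g → 𝟙 (g ≟ 1)) (trans (gcd[n,n]≡n e) (sym (gcd-identityˡ e)))

∑𝟙[gcd≡d]≡φ : ∀ e d → ∑[ l < e * suc d ] 𝟙 (gcd l (e * suc d) ≟ suc d) ≡ φ e
∑𝟙[gcd≡d]≡φ e d = begin
  ∑[ l < e * D ] 𝟙 (gcd l (e * D) ≟ D)                  ≡⟨ ∑-blocks e D _ ⟩
  ∑[ j < e ] ∑[ r < D ] 𝟙 (gcd (j * D + r) (e * D) ≟ D)  ≡⟨ ∑-cong e (λ {j} _ → block j) ⟩
  ∑[ j < e ] 𝟙 (gcd j e ≟ 1)                             ≡⟨ sym (φ≡∑-coprime e) ⟩
  φ e                                                    ∎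
  where
  D = suc d
  block : ∀ j → ∑[ r < D ] 𝟙 (gcd (j * D + r) (e * D) ≟ D) ≡ 𝟙 (gcd j e ≟ 1)
  block j = trans (cong₂ _+_ multiple (∑-zero d non-multiple)) (+-identityʳ _)
    where
    gcd-scaled : gcd (j * D + 0) (e * D) ≡ D * gcd j e
    gcd-scaled = trans (cong₂ gcd (trans (+-identityʳ (j * D)) (*-comm j D)) (*-comm e D))
                       (sym (c*gcd[m,n]≡gcd[cm,cn] D j e))
    multiple : 𝟙 (gcd (j * D + 0) (e * D) ≟ D) ≡ 𝟙 (gcd j e ≟ 1)
    multiple = 𝟙-cong _ _ (mk⇔
      (λ eq → *-cancelˡ-≡ (gcd j e) 1 D (trans (sym gcd-scaled) (trans eq (sym (*-identityʳ D)))))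
      (λ eq → trans gcd-scaled (trans (cong (D *_) eq) (*-identityʳ D))))
    non-multiple : ∀ {r} → r < d → 𝟙 (gcd (j * D + suc r) (e * D) ≟ D) ≡ 0
    non-multiple {r} r<d = 𝟙-no _ λ eq →
      <⇒≱ (s<s r<d) (∣⇒≤ (∣m+n∣m⇒∣n (subst (_∣ j * D + suc r) eq (gcd[m,n]∣m _ _)) (n∣m*n j)))

∑𝟙[cofactor]≡1 : ∀ m {G} → G ∣ suc m → ∑[ i < suc m ] 𝟙 (suc i * G ≟ suc m) ≡ 1
∑𝟙[cofactor]≡1 m {G} (divides (suc q) M≡q*G) =
  ∑-𝟙-unique (suc m) (λ i → suc i * G ≟ suc m) q<M (sym M≡q*G)
    (λ eq → suc-injective (*-cancelʳ-≡ _ _ G {{G-nonZero}} (trans eq M≡q*G)))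
  where
  q<M : q < suc m
  q<M = ∣⇒≤ (divides G (trans M≡q*G (*-comm (suc q) G)))
  G-nonZero : NonZero G
  G-nonZero = ≢-nonZero λ { refl → 1+n≢0 (trans M≡q*G (*-zeroʳ (suc q))) }

module _ (m : ℕ) {Q : ℕ → Set ℓ} {R : ℕ → Set ℓ′} (Q? : Decidable Q) (R? : Decidable R)
         (R⇔cofactor : ∀ e → R e ⇔ (∃[ d ] suc m ≡ d * e × Q d)) where

  private
    M : ℕ
    M = suc m

  ∑𝟙[cofactor-gcd]≡φ : ∀ e .{{_ : NonZero e}} →
    ∑[ l < M ] (𝟙 (e * gcd l M ≟ M) * 𝟙 (Q? (gcd l M))) ≡ φ e * 𝟙 (R? e)
  ∑𝟙[cofactor-gcd]≡φ e with e ∣? M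
  ... | no e∤M = begin
    ∑[ l < M ] (𝟙 (e * gcd l M ≟ M) * 𝟙 (Q? (gcd l M)))
      ≡⟨ ∑-zero M (λ {l} _ → cong (_* 𝟙 (Q? (gcd l M)))
                                  (𝟙-no (e * gcd l M ≟ M) (e∤M ∘ cofactor⇒∣))) ⟩
    0                ≡⟨ sym (*-zeroʳ (φ e)) ⟩
    φ e * 0          ≡⟨ cong (φ e *_) (sym (𝟙-no (R? e) (e∤M ∘ R⇒∣))) ⟩
    φ e * 𝟙 (R? e)   ∎
    where
    cofactor⇒∣ : ∀ {G} → e * G ≡ M → e ∣ M
    cofactor⇒∣ {G} e*G≡M = divides G (trans (sym e*G≡M) (*-comm e G))
    R⇒∣ : R e → e ∣ M
    R⇒∣ Re = let d , M≡d*e , _ = to (R⇔cofactor e) Re in divides d M≡d*e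
  ... | yes (divides zero ())
  ... | yes (divides (suc d) M≡D*e) = begin
    ∑[ l < M ] (𝟙 (e * gcd l M ≟ M) * 𝟙 (Q? (gcd l M)))
      ≡⟨ ∑-cong M (λ {l} _ → only-D (gcd l M)) ⟩
    ∑[ l < M ] (𝟙 (gcd l M ≟ D) * 𝟙 (Q? D))
      ≡⟨ ∑-distribʳ-* M (λ l → 𝟙 (gcd l M ≟ D)) (𝟙 (Q? D)) ⟩
    (∑[ l < M ] 𝟙 (gcd l M ≟ D)) * 𝟙 (Q? D)
      ≡⟨ cong₂ _*_ count-gcd≡D (𝟙-cong _ _ QD⇔Re) ⟩
    φ e * 𝟙 (R? e)  ∎
    where
    D = suc d
    M≡e*D : M ≡ e * D
    M≡e*D = trans M≡D*e (*-comm D e)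
    only-D : ∀ G → 𝟙 (e * G ≟ M) * 𝟙 (Q? G) ≡ 𝟙 (G ≟ D) * 𝟙 (Q? D)
    only-D G with G ≟ D
    ... | yes refl = cong (_* _) (𝟙-yes (e * D ≟ M) (sym M≡e*D))
    ... | no G≢D   = cong (_* _) (𝟙-no (e * G ≟ M) λ eq → G≢D (*-cancelˡ-≡ G D e (trans eq M≡e*D)))
    count-gcd≡D : ∑[ l < M ] 𝟙 (gcd l M ≟ D) ≡ φ e
    count-gcd≡D = subst (λ N → ∑[ l < N ] 𝟙 (gcd l N ≟ D) ≡ φ e) (sym M≡e*D) (∑𝟙[gcd≡d]≡φ e d)
    QD⇔Re : Q D ⇔ R e
    QD⇔Re = mk⇔ (λ QD → from (R⇔cofactor e) (D , M≡D*e , QD))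
      λ Re → let d′ , M≡d′*e , Qd′ = to (R⇔cofactor e) Re in
             subst Q (*-cancelʳ-≡ d′ D e (trans (sym M≡d′*e) M≡D*e)) Qd′

  ∑𝟙-gcd-invariant≡∑φ : (∀ l → Q l ⇔ Q (gcd l M)) →
    ∑[ l < M ] 𝟙 (Q? l) ≡ ∑[ i < M ] (φ (suc i) * 𝟙 (R? (suc i)))
  ∑𝟙-gcd-invariant≡∑φ Q⇔Q-gcd = begin
    ∑[ l < M ] 𝟙 (Q? l)
      ≡⟨ ∑-cong M (λ {l} _ → 𝟙-cong (Q? l) (Q? (gcd l M)) (Q⇔Q-gcd l)) ⟩
    ∑[ l < M ] 𝟙 (Q? (gcd l M))
      ≡⟨ ∑-cong M (λ {l} _ → sym (unique-cofactor l)) ⟩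
    ∑[ l < M ] ∑[ i < M ] (𝟙 (suc i * gcd l M ≟ M) * 𝟙 (Q? (gcd l M)))
      ≡⟨ ∑-comm M M (λ l i → 𝟙 (suc i * gcd l M ≟ M) * 𝟙 (Q? (gcd l M))) ⟩
    ∑[ i < M ] ∑[ l < M ] (𝟙 (suc i * gcd l M ≟ M) * 𝟙 (Q? (gcd l M)))
      ≡⟨ ∑-cong M (λ {i} _ → ∑𝟙[cofactor-gcd]≡φ (suc i)) ⟩
    ∑[ i < M ] (φ (suc i) * 𝟙 (R? (suc i)))  ∎
    where
    unique-cofactor : ∀ l → ∑[ i < M ] (𝟙 (suc i * gcd l M ≟ M) * 𝟙 (Q? (gcd l M))) ≡ 𝟙 (Q? (gcd l M))
    unique-cofactor l = begin
      ∑[ i < M ] (𝟙 (suc i * gcd l M ≟ M) * 𝟙 (Q? (gcd l M)))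
        ≡⟨ ∑-distribʳ-* M (λ i → 𝟙 (suc i * gcd l M ≟ M)) (𝟙 (Q? (gcd l M))) ⟩
      (∑[ i < M ] 𝟙 (suc i * gcd l M ≟ M)) * 𝟙 (Q? (gcd l M))
        ≡⟨ cong (_* 𝟙 (Q? (gcd l M))) (∑𝟙[cofactor]≡1 m (gcd[m,n]∣n l M)) ⟩
      1 * 𝟙 (Q? (gcd l M))
        ≡⟨ *-identityˡ _ ⟩
      𝟙 (Q? (gcd l M))  ∎

-- Periodic functions

Periodic : (ℕ → A) → ℕ → Set _
Periodic f p = ∀ i → f (i + p) ≡ f i

module _ {f : ℕ → A} where

  periodic-0 : Periodic f 0
  periodic-0 i = cong f (+-identityʳ i)

  periodic-+ : ∀ {p q} → Periodic f p → Periodic f q → Periodic f (p + q)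
  periodic-+ {p} {q} fp fq i = trans (cong f (sym (+-assoc i p q))) (trans (fq (i + p)) (fp i))

  periodic-* : ∀ c {p} → Periodic f p → Periodic f (c * p)
  periodic-* zero    _  = periodic-0
  periodic-* (suc c) fp = periodic-+ fp (periodic-* c fp)

  periodic-∣ : ∀ {p q} → p ∣ q → Periodic f p → Periodic f q
  periodic-∣ (divides c refl) fp = periodic-* c fp

  periodic-cancel : ∀ {p q} → Periodic f (p + q) → Periodic f q → Periodic f p
  periodic-cancel {p} {q} fpq fq i = trans (sym (fq (i + p))) (trans (cong f (+-assoc i p q)) (fpq i))

  periodic-gcd : ∀ {p q} → Periodic f p → Periodic f q → Periodic f (gcd p q)
  periodic-gcd {p} {q} fp fq with Bézout.identity (gcd-GCD p q)
  ... | Bézout.+- x y d+yq≡xp =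
    periodic-cancel (subst (Periodic f) (sym d+yq≡xp) (periodic-* x fp)) (periodic-* y fq)
  ... | Bézout.-+ x y d+xp≡yq =
    periodic-cancel (subst (Periodic f) (sym d+xp≡yq) (periodic-* y fq)) (periodic-* x fp)

  periodic⇔periodic-gcd : ∀ {M} l → Periodic f M → Periodic f l ⇔ Periodic f (gcd l M)
  periodic⇔periodic-gcd {M} l fM = mk⇔ (λ fl → periodic-gcd fl fM) (periodic-∣ (gcd[m,n]∣m l M))

  periodic-from-residues : ∀ {M p} .{{_ : NonZero M}} → Periodic f M →
    (∀ (j : Fin M) → f (toℕ j + p) ≡ f (toℕ j)) → Periodic f p
  periodic-from-residues {M} {p} fM fp i = begin
    f (i + p)                  ≡⟨ cong (λ n → f (n + p)) i≡r+q*M ⟩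
    f (i % M + i / M * M + p)  ≡⟨ cong f (xy∙z≈xz∙y (i % M) (i / M * M) p) ⟩
    f (i % M + p + i / M * M)  ≡⟨ periodic-* (i / M) fM (i % M + p) ⟩
    f (i % M + p)              ≡⟨ cong (λ n → f (n + p)) (sym (toℕ-fromℕ< (m%n<n i M))) ⟩
    f (toℕ (i mod M) + p)      ≡⟨ fp (i mod M) ⟩
    f (toℕ (i mod M))          ≡⟨ cong f (toℕ-fromℕ< (m%n<n i M)) ⟩
    f (i % M)                  ≡⟨ sym (periodic-* (i / M) fM (i % M)) ⟩
    f (i % M + i / M * M)      ≡⟨ cong f (sym i≡r+q*M) ⟩
    f i                        ∎
    where
    i≡r+q*M : i ≡ i % M + i / M * M
    i≡r+q*M = m≡m%n+[m/n]*n i M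

-- Rotations and powers of a sequence

at : List ℕ → ℕ → ℕ
at []       _       = 0
at (x ∷ _)  zero    = x
at (_ ∷ xs) (suc j) = at xs j

at-toList : ∀ {n} (v : Vec ℕ n) (i : Fin n) → at (toList v) (toℕ i) ≡ lookup v i
at-toList (x ∷ᵥ _) fzero    = refl
at-toList (_ ∷ᵥ v) (fsuc i) = at-toList v i

at-ext : ∀ xs ys → length xs ≡ length ys → (∀ {j} → j < length xs → at xs j ≡ at ys j) → xs ≡ ys
at-ext []       []       _       _  = refl
at-ext (x ∷ xs) (y ∷ ys) |xs|≡|ys| eq =
  cong₂ _∷_ (eq z<s) (at-ext xs ys (suc-injective |xs|≡|ys|) (eq ∘ s<s))

at-++ˡ : ∀ xs ys {j} → j < length xs → at (xs ++ ys) j ≡ at xs j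
at-++ˡ (x ∷ xs) ys {zero}  _         = refl
at-++ˡ (x ∷ xs) ys {suc j} (s<s j<n) = at-++ˡ xs ys j<n

at-++ʳ : ∀ xs ys j → at (xs ++ ys) (length xs + j) ≡ at ys j
at-++ʳ []       ys j = refl
at-++ʳ (_ ∷ xs) ys j = at-++ʳ xs ys j

at-take : ∀ n xs {j} → j < n → at (take n xs) j ≡ at xs j
at-take (suc n) []       _         = refl
at-take (suc n) (x ∷ xs) {zero}  _ = refl
at-take (suc n) (x ∷ xs) {suc j} (s<s j<n) = at-take n xs j<n

length-concat-replicate : ∀ e (t : List A) → length (concat (replicate e t)) ≡ e * length t
length-concat-replicate zero    t = refl
length-concat-replicate (suc e) t = trans (length-++ t) (cong (length t +_) (length-concat-replicate e t))

at-concat-replicate : ∀ e t {q r} → q < e → r < length t →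
                      at (concat (replicate e t)) (r + q * length t) ≡ at t r
at-concat-replicate (suc e) t {zero}  {r} _ r<|t| =
  trans (cong (at (t ++ concat (replicate e t))) (+-identityʳ r)) (at-++ˡ t (concat (replicate e t)) r<|t|)
at-concat-replicate (suc e) t {suc q} {r} (s<s q<e) r<|t| = begin
  at (t ++ tᵉ) (r + (length t + q * length t))  ≡⟨ cong (at (t ++ tᵉ)) (x∙yz≈y∙xz r (length t) _) ⟩
  at (t ++ tᵉ) (length t + (r + q * length t))  ≡⟨ at-++ʳ t tᵉ _ ⟩
  at tᵉ (r + q * length t)                      ≡⟨ at-concat-replicate e t q<e r<|t| ⟩
  at t r                                        ∎
  where
  tᵉ = concat (replicate e t)

at-concat-replicate-% : ∀ e t {d} .{{_ : NonZero d}} → length t ≡ d →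
  ∀ {j} → j < e * d → at (concat (replicate e t)) j ≡ at t (j % d)
at-concat-replicate-% e t {d} refl {j} j<e*d =
  trans (cong (at (concat (replicate e t))) (m≡m%n+[m/n]*n j d))
        (at-concat-replicate e t (m<n*o⇒m/o<n j<e*d) (m%n<n j d))

rotate-fixed⇔shift-invariant : ∀ {M} (l : Fin M) (s : Vec ℕ M) →
  rotate l s ≡ s ⇔ (∀ j → lookup s (shift j (toℕ l)) ≡ lookup s j)
rotate-fixed⇔shift-invariant l s = mk⇔
  (λ eq j → trans (sym (lookup∘tabulate _ j)) (cong (λ v → lookup v j) eq))
  (λ inv → trans (tabulate-cong inv) (tabulate∘lookup s))

module _ {m : ℕ} (s : Vec ℕ (suc m)) where

  private
    M : ℕ
    M = suc m
    xs : List ℕ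
    xs = toList s

  cyclic : ℕ → ℕ
  cyclic j = at xs (j % M)

  cyclic-periodic : Periodic cyclic M
  cyclic-periodic i = cong (at xs) ([m+n]%n≡m%n i M)

  cyclic-below : ∀ {j} → j < M → cyclic j ≡ at xs j
  cyclic-below j<M = cong (at xs) (m<n⇒m%n≡m j<M)

  shift-invariant⇔periodic : ∀ p → (∀ j → lookup s (shift j p) ≡ lookup s j) ⇔ Periodic cyclic p
  shift-invariant⇔periodic p = mk⇔
    (λ inv → periodic-from-residues cyclic-periodic λ j →
      trans (sym (lookup-mod (toℕ j + p))) (trans (inv j) (lookup≡cyclic j)))
    (λ per j → trans (lookup-mod (toℕ j + p)) (trans (per (toℕ j)) (sym (lookup≡cyclic j))))
    where
    lookup-mod : ∀ n → lookup s (n mod M) ≡ cyclic n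
    lookup-mod n = trans (sym (at-toList s (n mod M))) (cong (at xs) (toℕ-fromℕ< (m%n<n n M)))
    lookup≡cyclic : ∀ j → lookup s j ≡ cyclic (toℕ j)
    lookup≡cyclic j = trans (sym (at-toList s j)) (sym (cyclic-below (toℕ<n j)))

  periodic? : Decidable (Periodic cyclic)
  periodic? p = map′ (to (shift-invariant⇔periodic p)) (from (shift-invariant⇔periodic p))
                     (all? λ j → lookup s (shift j p) ≟ lookup s j)

  isPower⇔periodic : ∀ e → IsPower e xs ⇔ (∃[ d ] M ≡ d * e × Periodic cyclic d)
  isPower⇔periodic e = mk⇔ power⇒periodic periodic⇒power
    where
    |xs|≡M : length xs ≡ M
    |xs|≡M = length-toList s

    M≡e*|t| : ∀ {t} → xs ≡ concat (replicate e t) → M ≡ e * length t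
    M≡e*|t| {t} xs≡tᵉ = trans (sym |xs|≡M) (trans (cong length xs≡tᵉ) (length-concat-replicate e t))

    power⇒periodic : IsPower e xs → ∃[ d ] M ≡ d * e × Periodic cyclic d
    power⇒periodic (t , xs≡tᵉ) with length t in |t|≡L | M≡e*|t| xs≡tᵉ
    ... | zero      | M≡e*0 = contradiction (trans M≡e*0 (*-zeroʳ e)) 1+n≢0
    ... | L@(suc _) | M≡e*L = L , trans M≡e*L (*-comm e L) , periodic
      where
      cyclic≡at-t : ∀ j → cyclic j ≡ at t (j % L)
      cyclic≡at-t j = begin
        at xs (j % M)
          ≡⟨ cong (λ ys → at ys (j % M)) xs≡tᵉ ⟩
        at (concat (replicate e t)) (j % M)
          ≡⟨ at-concat-replicate-% e t |t|≡L (subst (j % M <_) M≡e*L (m%n<n j M)) ⟩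
        at t (j % M % L)
          ≡⟨ cong (at t) (m∣n⇒o%n%m≡o%m L M j (divides e M≡e*L)) ⟩
        at t (j % L)  ∎
      periodic : Periodic cyclic L
      periodic i = trans (cyclic≡at-t (i + L)) (trans (cong (at t) ([m+n]%n≡m%n i L)) (sym (cyclic≡at-t i)))

    periodic⇒power : (∃[ d ] M ≡ d * e × Periodic cyclic d) → IsPower e xs
    periodic⇒power (zero , () , _)
    periodic⇒power (suc d , M≡D*e , per) = t , at-ext xs tᵉ |xs|≡|tᵉ| agree
      where
      D = suc d
      t = take D xs
      tᵉ = concat (replicate e t)
      M≡e*D : M ≡ e * D
      M≡e*D = trans M≡D*e (*-comm D e)
      D≤M : D ≤ M
      D≤M = ∣⇒≤ (divides e M≡e*D)
      |t|≡D : length t ≡ D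
      |t|≡D = trans (length-take D xs) (trans (cong (D ⊓_) |xs|≡M) (m≤n⇒m⊓n≡m D≤M))
      |xs|≡|tᵉ| : length xs ≡ length tᵉ
      |xs|≡|tᵉ| = trans |xs|≡M (trans M≡e*D (sym (trans (length-concat-replicate e t) (cong (e *_) |t|≡D))))
      agree : ∀ {j} → j < length xs → at xs j ≡ at tᵉ j
      agree {j} j<|xs| = begin
        at xs j                     ≡⟨ sym (cyclic-below j<M) ⟩
        cyclic j                    ≡⟨ cong cyclic (m≡m%n+[m/n]*n j D) ⟩
        cyclic (j % D + j / D * D)  ≡⟨ periodic-* (j / D) per (j % D) ⟩
        cyclic (j % D)              ≡⟨ cyclic-below (<-≤-trans (m%n<n j D) D≤M) ⟩
        at xs (j % D)               ≡⟨ sym (at-take D xs (m%n<n j D)) ⟩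
        at t (j % D)                ≡⟨ sym (at-concat-replicate-% e t |t|≡D (subst (j <_) M≡e*D j<M)) ⟩
        at tᵉ j                     ∎
        where
        j<M : j < M
        j<M = subst (j <_) |xs|≡M j<|xs|

  ∑𝟙-periodic≡∑φ𝟙-isPower :
    ∑[ p < M ] 𝟙 (periodic? p) ≡ ∑[ i < M ] (φ (suc i) * 𝟙 (isPower? (suc i) xs))
  ∑𝟙-periodic≡∑φ𝟙-isPower = ∑𝟙-gcd-invariant≡∑φ m periodic? (λ e → isPower? e xs) isPower⇔periodic
                               (λ l → periodic⇔periodic-gcd l cyclic-periodic)

  ∑-nontrivial-rotations :
    sum (map (λ l → 𝟙 (¬? (toℕ l ≟ 0) ×-dec ≡-dec _≟_ (rotate l s) s)) (allFin M))
    ≡ sum (map (λ e → φ e * 𝟙 (isPower? e xs)) (from2to M))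
  ∑-nontrivial-rotations = begin
    sum (map nontrivial-fixing (allFin M))
      ≡⟨ cong sum (map-tabulate (λ l → l) nontrivial-fixing) ⟩
    sum (tabulate nontrivial-fixing)
      ≡⟨ sum-tabulate M {g = λ p → 𝟙 (¬? (p ≟ 0)) * 𝟙 (periodic? p)} as-periodic ⟩
    ∑[ p < M ] (𝟙 (¬? (p ≟ 0)) * 𝟙 (periodic? p))
      ≡⟨ drop-0 ⟩
    ∑[ j < m ] 𝟙 (periodic? (suc j))
      ≡⟨ suc-injective count ⟩
    ∑[ i < m ] (φ (2 + i) * 𝟙 (isPower? (2 + i) xs))
      ≡⟨ sym (sum-map-upTo _ m) ⟩
    sum (map (λ i → φ (2 + i) * 𝟙 (isPower? (2 + i) xs)) (upTo m))
      ≡⟨ cong sum (map-∘ (upTo m)) ⟩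
    sum (map (λ e → φ e * 𝟙 (isPower? e xs)) (from2to M))  ∎
    where
    nontrivial-fixing : Fin M → ℕ
    nontrivial-fixing l = 𝟙 (¬? (toℕ l ≟ 0) ×-dec ≡-dec _≟_ (rotate l s) s)
    as-periodic : ∀ l → nontrivial-fixing l ≡ 𝟙 (¬? (toℕ l ≟ 0)) * 𝟙 (periodic? (toℕ l))
    as-periodic l = trans (𝟙-× (¬? (toℕ l ≟ 0)) (≡-dec _≟_ (rotate l s) s))
      (cong (𝟙 (¬? (toℕ l ≟ 0)) *_)
            (𝟙-cong _ _ (⇔-trans (rotate-fixed⇔shift-invariant l s) (shift-invariant⇔periodic (toℕ l)))))
    drop-0 : ∑[ p < M ] (𝟙 (¬? (p ≟ 0)) * 𝟙 (periodic? p)) ≡ ∑[ j < m ] 𝟙 (periodic? (suc j))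
    drop-0 = cong₂ _+_ (cong (_* 𝟙 (periodic? 0)) (𝟙-no (¬? (0 ≟ 0)) (λ 0≢0 → 0≢0 refl)))
      (∑-cong m λ {j} _ → trans (cong (_* 𝟙 (periodic? (suc j))) (𝟙-yes (¬? (suc j ≟ 0)) 1+n≢0))
                                (*-identityˡ _))
    count : 1 + ∑[ j < m ] 𝟙 (periodic? (suc j))
          ≡ 1 + ∑[ i < m ] (φ (2 + i) * 𝟙 (isPower? (2 + i) xs))
    count = begin
      1 + ∑[ j < m ] 𝟙 (periodic? (suc j))
        ≡⟨ cong (_+ ∑[ j < m ] 𝟙 (periodic? (suc j))) (sym (𝟙-yes (periodic? 0) periodic-0)) ⟩
      ∑[ p < M ] 𝟙 (periodic? p)
        ≡⟨ ∑𝟙-periodic≡∑φ𝟙-isPower ⟩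
      ∑[ i < M ] (φ (suc i) * 𝟙 (isPower? (suc i) xs))
        ≡⟨ cong (λ n → φ 1 * n + ∑[ i < m ] (φ (2 + i) * 𝟙 (isPower? (2 + i) xs)))
                (𝟙-yes (isPower? 1 xs) (xs , sym (++-identityʳ xs))) ⟩
      1 + ∑[ i < m ] (φ (2 + i) * 𝟙 (isPower? (2 + i) xs))  ∎

lemma1 : (k n : ℕ) → 1 ≤ k →
    rotWheelCount k n ≡ sum (map (λ e → φ e * powerWheelCount e k n) (from2to (k + k)))
lemma1 k@(suc _) n _ = begin
  rotWheelCount k n
    ≡⟨ length-filter≡sum-𝟙 (isRotWheel? k) (cartesianProduct W (allFin (k + k))) ⟩
  sum (map (𝟙 ∘ isRotWheel? k) (cartesianProduct W (allFin (k + k))))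
    ≡⟨ sum-map-cartesianProduct (𝟙 ∘ isRotWheel? k) W (allFin (k + k)) ⟩
  sum (map (λ s → sum (map (λ l → 𝟙 (isRotWheel? k (s , l))) (allFin (k + k)))) W)
    ≡⟨ cong sum (map-cong ∑-nontrivial-rotations W) ⟩
  sum (map (λ s → sum (map (λ e → φ e * power e s) E)) W)
    ≡⟨ sum-map-comm (λ s e → φ e * power e s) W E ⟩
  sum (map (λ e → sum (map (λ s → φ e * power e s) W)) E)
    ≡⟨ cong sum (map-cong (λ e → trans (sum-map-*ˡ (φ e) (power e) W)
                                       (cong (φ e *_) (sym (length-filter≡sum-𝟙 _ W)))) E) ⟩
  sum (map (λ e → φ e * powerWheelCount e k n) E)  ∎
  where
  W = wheels k n
  E = from2to (k + k)
  power : ℕ → Vec ℕ (k + k) → ℕ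
  power e s = 𝟙 (isPower? e (toList s))
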